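{- Let $\mathbf{K}$ be an order-enriched, left distributive category with arbitrary non-empty joins, let $J\colon\mathbf{J}\to\mathbf{K}$ and $I\colon\mathbf{I}\to\mathbf{J}$ be wide subcategory inclusions, let $q\colon M\to N$ be a surjective monoid homomorphism, and let $\pi$ be a lax functor from $\mathbf{M}$ to $\mathbf{K}$. If $f$ is a $q$-behavioural morphism for $\pi$ regarded as an object of $[\mathbf{M},\mathbf{K}]^{J\circ I}$, then ($I(f)$) is a $q$-behavioural morphism for $\pi$ regarded as an object of $[\mathbf{M},\mathbf{K}]^J$.
   Context: Order-enriched: hom-sets partially ordered, composition monotone; arbitrary non-empty joins; left distributive: $g\circ\bigvee_i g_i=\bigvee_i g\circ g_i$ for non-empty families. A wide subcategory inclusion is identity on objects, injective on morphisms. A monoid is a one-object category; a lax functor $\pi$ from $\mathbf{M}$ to $\mathbf{K}$ is an object $\pi(\ast)$ with endomorphisms $\pi_m$, $id\leq\pi_1$, $\pi_m\circ\pi_{m'}\leq\pi_{mm'}$. For a wide subcategory inclusion $H\colon\mathbf{H}\to\mathbf{K}$, $[\mathbf{M},\mathbf{K}]^H$ has lax functors as objects and as morphisms $\pi\to\pi'$ the morphisms $f$ of $\mathbf{H}$ with $H(f)\circ\pi_m\leq\pi'_m\circ H(f)$. $\Sigma_q^H(\pi)$ is the lax functor from $\mathbf{N}$ with $\Sigma_q^H(\pi)(\ast)=\pi(\ast)$, $\Sigma_q^H(\pi)_n=\bigvee_{i<\omega}\Pi_{n,i}$, $\Pi_{n,0}=\bigvee\{\pi_m\mid q(m)=n\}$,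 $\Pi_{n,i+1}=\bigvee\{\Pi_{n_1,i}\circ\cdots\circ\Pi_{n_l,i}\mid l\ge1,\ n_1\cdots n_l=n\}$ (left 2-adjoint to $\pi'\mapsto\pi'\circ q$). A $q$-behavioural morphism for $\pi\in[\mathbf{M},\mathbf{K}]^H$ is a morphism $f\colon\pi(\ast)\to Y$ of $\mathbf{H}$ for which some $\pi''\in[\mathbf{N},\mathbf{K}]^H$ with $\pi''(\ast)=Y$ satisfies $H(f)\circ\Sigma_q^H(\pi)_n=\pi''_n\circ H(f)$ for all $n\in N$. -}

module Defs where

open import Level using (Level; _⊔_; Lift; lift) renaming (suc to lsuc)
open import Data.Nat using (ℕ; zero; suc)
open import Data.Product using (Σ; _,_; proj₁)
open import Data.List.NonEmpty using (List⁺; [_]; foldr₁; map)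
open import Relation.Binary.PropositionalEquality using (_≡_)
open import Relation.Binary.Structures using (IsPartialOrder)
open import Algebra.Bundles using (Monoid)
open import Algebra.Morphism.Structures using (module MonoidMorphisms)

record Category (o h : Level) : Set (lsuc (o ⊔ h)) where
  infixr 9 _∘_
  field
    Obj  : Set o
    Hom  : Obj → Obj → Set h
    id   : ∀ {A} → Hom A A
    _∘_  : ∀ {A B C} → Hom B C → Hom A B → Hom A C
    identityˡ : ∀ {A B} (f : Hom A B) → id ∘ f ≡ f
    identityʳ : ∀ {A B} (f : Hom A B) → f ∘ id ≡ f
    assoc : ∀ {A B C D} (h : Hom C D) (g : Hom B C) (f : Hom A B) →
            (h ∘ g) ∘ f ≡ h ∘ (g ∘ f)

-- A wide subcategory inclusion S → D: a category S with the same objects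
-- as D (identity on objects) and a faithful (injective on morphisms)
-- functor into D which is the identity on objects.

record WideSubcategory {o h} (D : Category o h) (h' : Level)
       : Set (lsuc (o ⊔ h ⊔ h')) where
  open Category D
  field
    SHom  : Obj → Obj → Set h'
    sid   : ∀ {A} → SHom A A
    _⊚_   : ∀ {A B C} → SHom B C → SHom A B → SHom A C
    sidentityˡ : ∀ {A B} (f : SHom A B) → sid ⊚ f ≡ f
    sidentityʳ : ∀ {A B} (f : SHom A B) → f ⊚ sid ≡ f
    sassoc : ∀ {A B C D} (h : SHom C D) (g : SHom B C) (f : SHom A B) →
             (h ⊚ g) ⊚ f ≡ h ⊚ (g ⊚ f)
    incl       : ∀ {A B} → SHom A B → Hom A B
    incl-id    : ∀ {A} → incl (sid {A}) ≡ id
    incl-∘     : ∀ {A B C} (g : SHom B C) (f : SHom A B) →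
                 incl (g ⊚ f) ≡ incl g ∘ incl f
    incl-inj   : ∀ {A B} (f g : SHom A B) → incl f ≡ incl g → f ≡ g

Sub : ∀ {o h h'} {D : Category o h} → WideSubcategory D h' → Category o h'
Sub {D = D} S = record
  { Obj = Category.Obj D ; Hom = SHom ; id = sid ; _∘_ = _⊚_
  ; identityˡ = sidentityˡ ; identityʳ = sidentityʳ ; assoc = sassoc }
  where open WideSubcategory S

_⊙_ : ∀ {o h hJ hI} {D : Category o h} (J : WideSubcategory D hJ) →
      WideSubcategory (Sub J) hI → WideSubcategory D hI
_⊙_ {D = D} J I = record
  { SHom = I.SHom ; sid = I.sid ; _⊚_ = I._⊚_
  ; sidentityˡ = I.sidentityˡ ; sidentityʳ = I.sidentityʳ ; sassoc = I.sassoc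
  ; incl = λ f → J.incl (I.incl f)
  ; incl-id = trans (cong J.incl I.incl-id) J.incl-id
  ; incl-∘ = λ g f → trans (cong J.incl (I.incl-∘ g f)) (J.incl-∘ (I.incl g) (I.incl f))
  ; incl-inj = λ f g e → I.incl-inj f g (J.incl-inj (I.incl f) (I.incl g) e) }
  where
  module J = WideSubcategory J
  module I = WideSubcategory I
  open import Relation.Binary.PropositionalEquality using (trans; cong)

record OrderEnrichedCategory (o h ℓ ι : Level) : Set (lsuc (o ⊔ h ⊔ ℓ ⊔ ι)) where
  field
    cat : Category o h
  open Category cat public
  infix 4 _≤_
  field
    _≤_  : ∀ {A B} → Hom A B → Hom A B → Set ℓ
    ≤-isPartialOrder : ∀ {A B} → IsPartialOrder (_≡_ {A = Hom A B}) _≤_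
    ∘-mono : ∀ {A B C} {g g' : Hom B C} {f f' : Hom A B} →
             g ≤ g' → f ≤ f' → g ∘ f ≤ g' ∘ f'
    -- join of a non-empty family (non-emptiness witnessed by an index i₀)
    ⋁ : ∀ {A B} (Ix : Set ι) → Ix → (Ix → Hom A B) → Hom A B
    ⋁-upper : ∀ {A B} (Ix : Set ι) (i₀ : Ix) (F : Ix → Hom A B) (i : Ix) →
              F i ≤ ⋁ Ix i₀ F
    ⋁-least : ∀ {A B} (Ix : Set ι) (i₀ : Ix) (F : Ix → Hom A B) (g : Hom A B) →
              (∀ i → F i ≤ g) → ⋁ Ix i₀ F ≤ g
    left-distrib : ∀ {A B C} (g : Hom B C) (Ix : Set ι) (i₀ : Ix) (F : Ix → Hom A B) →
                   g ∘ ⋁ Ix i₀ F ≡ ⋁ Ix i₀ (λ i → g ∘ F i)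

record SurjectiveHomomorphism {c ℓ c' ℓ'} (M : Monoid c ℓ) (N : Monoid c' ℓ')
       : Set (c ⊔ ℓ ⊔ c' ⊔ ℓ') where
  module M = Monoid M
  module N = Monoid N
  open MonoidMorphisms M.rawMonoid N.rawMonoid
  field
    ⟦_⟧ : M.Carrier → N.Carrier
    isMonoidHomomorphism : IsMonoidHomomorphism ⟦_⟧
    surjective : ∀ n → Σ M.Carrier λ m → ⟦ m ⟧ N.≈ n

-- Lax functors from a monoid (one-object category) 𝐌 to 𝐊, with the image
-- π(∗) = X of the unique object fixed.  Morphisms of 𝐌 are elements of the
-- monoid, compared up to the monoid's equality, which π must respect.

record LaxStructure {c ℓ o h ℓ≤ ι} (M : Monoid c ℓ)
       (K : OrderEnrichedCategory o h ℓ≤ ι) (X : OrderEnrichedCategory.Obj K)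
       : Set (c ⊔ ℓ ⊔ h ⊔ ℓ≤) where
  open OrderEnrichedCategory K
  module M = Monoid M
  field
    act      : M.Carrier → Hom X X
    act-cong : ∀ {m m'} → m M.≈ m' → act m ≡ act m'
    lax-unit : id ≤ act M.ε
    lax-mult : ∀ m m' → act m ∘ act m' ≤ act (m M.∙ m')

record LaxFunctor {c ℓ o h ℓ≤ ι} (M : Monoid c ℓ)
       (K : OrderEnrichedCategory o h ℓ≤ ι) : Set (c ⊔ ℓ ⊔ o ⊔ h ⊔ ℓ≤) where
  field
    obj : OrderEnrichedCategory.Obj K
    str : LaxStructure M K obj
  open LaxStructure str public

-- The components Σ_q(π)_n of the left 2-adjoint, as in the paper:
--   Π_{n,0}   = ⋁ { π_m | q(m) = n }
--   Π_{n,i+1} = ⋁ { Π_{n₁,i} ∘ ⋯ ∘ Π_{n_l,i} | l ≥ 1, n₁ ⋯ n_l = n }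
--   Σ_q(π)_n  = ⋁_{i<ω} Π_{n,i}
-- (This formula does not depend on the subcategory H.)

module _ {ι o h ℓ≤} {K : OrderEnrichedCategory o h ℓ≤ ι}
         {M N : Monoid ι ι} (q : SurjectiveHomomorphism M N)
         (π : LaxFunctor M K) where
  open OrderEnrichedCategory K
  open SurjectiveHomomorphism q using (⟦_⟧; surjective)
  open LaxFunctor π using (obj; act)
  private
    module M = Monoid M
    module N = Monoid N

  prod⁺ : List⁺ N.Carrier → N.Carrier
  prod⁺ = foldr₁ N._∙_

  comp⁺ : List⁺ (Hom obj obj) → Hom obj obj
  comp⁺ = foldr₁ _∘_

  Π : ℕ → N.Carrier → Hom obj obj
  Π zero n =
    ⋁ (Σ M.Carrier λ m → ⟦ m ⟧ N.≈ n) (surjective n) (λ p → act (proj₁ p))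
  Π (suc i) n =
    ⋁ (Σ (List⁺ N.Carrier) λ ns → prod⁺ ns N.≈ n) ([ n ] , N.refl)
      (λ p → comp⁺ (map (Π i) (proj₁ p)))

  Σq : N.Carrier → Hom obj obj
  Σq n = ⋁ (Lift ι ℕ) (lift zero) (λ { (lift i) → Π i n })

IsBehavioural : ∀ {ι o h ℓ≤ h'} {K : OrderEnrichedCategory o h ℓ≤ ι}
  (H : WideSubcategory (OrderEnrichedCategory.cat K) h')
  {M N : Monoid ι ι} (q : SurjectiveHomomorphism M N) (π : LaxFunctor M K)
  {Y : OrderEnrichedCategory.Obj K} →
  WideSubcategory.SHom H (LaxFunctor.obj π) Y → Set (ι ⊔ h ⊔ ℓ≤)
IsBehavioural {K = K} H {M} {N} q π {Y} f =
  Σ (LaxStructure N K Y) λ π'' →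
    ∀ n → incl f ∘ Σq q π n ≡ LaxStructure.act π'' n ∘ incl f
  where
  open OrderEnrichedCategory K
  open WideSubcategory H using (incl)

module Submission where

-- Whether a morphism f of a wide subcategory 𝐇 is
-- q-behavioural for π depends on 𝐇 only through the morphism H(f) of 𝐊:
-- the components Σ_q^H(π)_n are given by a formula in 𝐊 that does not
-- mention 𝐇, and the witness π'' is a lax structure on Y in 𝐊.  Hence
-- (`behavioural-transfer`) if two subcategory morphisms have the same image
-- in 𝐊, one is q-behavioural exactly when the other is, with the same
-- witness π''.  For the composite inclusion J ∘ I the image of f in 𝐊 is
-- J(I(f)) (`composite-incl`), which is also the image of I(f) under J, so
-- Theorem 4.13 follows by transferring the witness along this equation.

open import Defs
open import Algebra.Bundles using (Monoid)
open import Data.Product using (_,_)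
open import Relation.Binary.PropositionalEquality using (_≡_; refl; subst)

composite-incl : ∀ {o h hJ hI} {D : Category o h}
  (J : WideSubcategory D hJ) (I : WideSubcategory (Sub J) hI)
  {A B : Category.Obj D} (f : WideSubcategory.SHom I A B) →
  WideSubcategory.incl (J ⊙ I) f ≡ WideSubcategory.incl J (WideSubcategory.incl I f)
composite-incl J I f = refl

behavioural-transfer : ∀ {ι o h ℓ≤ hH hH'} {K : OrderEnrichedCategory o h ℓ≤ ι}
  (H : WideSubcategory (OrderEnrichedCategory.cat K) hH)
  (H' : WideSubcategory (OrderEnrichedCategory.cat K) hH')
  {M N : Monoid ι ι} (q : SurjectiveHomomorphism M N) (π : LaxFunctor M K)
  {Y : OrderEnrichedCategory.Obj K}
  (f : WideSubcategory.SHom H (LaxFunctor.obj π) Y)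
  (f' : WideSubcategory.SHom H' (LaxFunctor.obj π) Y) →
  WideSubcategory.incl H f ≡ WideSubcategory.incl H' f' →
  IsBehavioural H q π f → IsBehavioural H' q π f'
behavioural-transfer {K = K} H H' q π f f' same-image (π'' , intertwines) =
  π'' , λ n → subst (λ g → g ∘ Σq q π n ≡ LaxStructure.act π'' n ∘ g)
                    same-image (intertwines n)
  where open OrderEnrichedCategory K using (_∘_)

theorem4p13 : ∀ {o h ℓ≤ ι hJ hI}
    (K : OrderEnrichedCategory o h ℓ≤ ι)
    (J : WideSubcategory (OrderEnrichedCategory.cat K) hJ)
    (I : WideSubcategory (Sub J) hI)
    (M N : Monoid ι ι) (q : SurjectiveHomomorphism M N)
    (π : LaxFunctor M K)
    {Y : OrderEnrichedCategory.Obj K}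
    (f : WideSubcategory.SHom I (LaxFunctor.obj π) Y) →
    IsBehavioural (J ⊙ I) q π f →
    IsBehavioural J q π (WideSubcategory.incl I f)
theorem4p13 K J I M N q π f =
  behavioural-transfer (J ⊙ I) J q π f (WideSubcategory.incl I f)
    (composite-incl J I f)
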